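{- In Morpion Solitaire 5D, starting from the standard initial configuration, the number of moves in any play cannot exceed $136$.
   Context: Morpion Solitaire 5D is a one-player game on the integer lattice $\mathbb{Z}^2$. Initially there are 36 crosses, placed on the lattice points lying on the boundary of the 12-sided polygon (a "Greek cross") with consecutive vertices $(3,0),(6,0),(6,3),(9,3),(9,6),(6,6),(6,9),(3,9),(3,6),(0,6),(0,3),(3,3)$; each of its 12 edges contains exactly 4 lattice points. A move consists of: (1) placing a new cross on a lattice point that currently has no cross; (2) drawing a line, i.e. a segment covering exactly 5 consecutive lattice points in one of the four directions (horizontal, vertical, or one of the two diagonals), such that all 5 covered points carry crosses and one of them is the cross placed in step (1). In the 5D variant, a newly drawn line may not share any lattice point with a previously drawn line of the same direction. The game is a sequence of legal moves; its score is the number of moves. -}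

module Defs where

open import Data.Nat using (ℕ)
open import Data.Integer using (ℤ; +_; -[1+_]; _+_; _*_)
open import Data.Product using (_×_; _,_; Σ; ∃; ∃-syntax)
open import Data.List using (List; []; _∷_; map; _++_)
open import Data.List.Membership.Propositional using (_∈_; _∉_)
open import Data.List.Relation.Unary.All using (All)
open import Relation.Binary.PropositionalEquality using (_≡_; _≢_)
open import Relation.Nullary using (¬_)

Point : Set
Point = ℤ × ℤ

pt : ℕ → ℕ → Point
pt x y = (+ x , + y)

-- The 36 initial crosses: lattice points on the boundary of the Greek cross
-- with vertices (3,0),(6,0),(6,3),(9,3),(9,6),(6,6),(6,9),(3,9),(3,6),(0,6),(0,3),(3,3).
initialCrosses : List Point
initialCrosses =
  pt 3 0 ∷ pt 4 0 ∷ pt 5 0 ∷ pt 6 0 ∷ pt 6 1 ∷ pt 6 2 ∷ pt 6 3 ∷ pt 7 3 ∷ pt 8 3 ∷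
  pt 9 3 ∷ pt 9 4 ∷ pt 9 5 ∷ pt 9 6 ∷ pt 8 6 ∷ pt 7 6 ∷ pt 6 6 ∷ pt 6 7 ∷ pt 6 8 ∷
  pt 6 9 ∷ pt 5 9 ∷ pt 4 9 ∷ pt 3 9 ∷ pt 3 8 ∷ pt 3 7 ∷ pt 3 6 ∷ pt 2 6 ∷ pt 1 6 ∷
  pt 0 6 ∷ pt 0 5 ∷ pt 0 4 ∷ pt 0 3 ∷ pt 1 3 ∷ pt 2 3 ∷ pt 3 3 ∷ pt 3 2 ∷ pt 3 1 ∷ []

data Dir : Set where
  horiz vert diag antidiag : Dir

dirVec : Dir → Point
dirVec horiz    = (+ 1 , + 0)
dirVec vert     = (+ 0 , + 1)
dirVec diag     = (+ 1 , + 1)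
dirVec antidiag = (+ 1 , -[1+ 0 ])

record Line : Set where
  constructor line
  field
    start : Point
    dir   : Dir
open Line public

shift : Point → Dir → ℕ → Point
shift (x , y) d k with dirVec d
... | (dx , dy) = (x + (+ k) * dx , y + (+ k) * dy)

linePoints : Line → List Point
linePoints (line p d) = map (shift p d) (0 ∷ 1 ∷ 2 ∷ 3 ∷ 4 ∷ [])

record Move : Set where
  constructor move
  field
    newCross : Point
    drawn    : Line
open Move public

-- A history is a list of moves, MOST RECENT FIRST.
History : Set
History = List Move

crosses : History → List Point
crosses []       = initialCrosses
crosses (m ∷ h)  = newCross m ∷ crosses h

lines : History → List Line
lines []      = []
lines (m ∷ h) = drawn m ∷ lines h

ShareCommonPoint : Line → Line → Set
ShareCommonPoint l l′ = ∃[ p ] (p ∈ linePoints l × p ∈ linePoints l′)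

LegalMove : History → Move → Set
LegalMove h m =
  (newCross m ∉ crosses h) ×
  (newCross m ∈ linePoints (drawn m)) ×
  All (λ p → p ∈ (newCross m ∷ crosses h)) (linePoints (drawn m)) ×
  All (λ l′ → dir l′ ≡ dir (drawn m) → ¬ ShareCommonPoint l′ (drawn m)) (lines h)

data Game : History → Set where
  begin : Game []
  step  : ∀ {h m} → Game h → LegalMove h m → Game (m ∷ h)

-- Say a cross c is *used in direction d* if some drawn line of direction d
-- passes through c; the usage of c is the number of such directions (at most 4), and the
-- potential of a position is the total usage of all crosses.
--  * Lower bound: a move draws a line through 5 distinct crosses, and by the 5D rule each of
--    them gains a new direction, so after k moves the potential is at least 5k.
--  * Upper bound: there are 36 + k crosses, each of usage at most 4.  Moreover the four newest
--    crosses p₁ (newest), …, p₄ can only lie on lines drawn after them; since two lines of a game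
--    share at most one point (different directions: elementary geometry; same direction: the 5D
--    rule), their total usage is at most 8 instead of 16.  Hence the potential is at most
--    4(36 + k) - 8, and 5k ≤ 4(36 + k) - 8 gives k ≤ 136.
-- The file first develops the integer geometry of lines, then indicators and finite sums, then
-- usage and hit counts of points, then the two bounds on the potential, and finally the theorem.
module Submission where

-- The constructor `begin` of `Game` is hidden: it would clash with `begin_` of equational reasoning.
open import Defs hiding (begin)
open import Data.Nat using (_≤_)
open import Data.List using (List; []; _∷_; _++_; length; upTo)
open import Data.Product using (_×_; _,_; proj₁; proj₂)
open import Data.List.Membership.Propositional using (_∈_; _∉_)
open import Data.List.Relation.Unary.Unique.Propositional using (Unique)
open import Relation.Binary.PropositionalEquality

-- Integer geometry of lines, in its own module so that the arithmetic of ℤ used here does not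
-- clash with that of ℕ used in the rest of the file.
module Geometry where

  open import Data.Integer using (ℤ; +_; -[1+_]; 0ℤ; _+_; _-_; _*_; NonZero)
  open import Data.Integer.Properties using (*-cancelˡ-≡; +-injective)
  open import Data.Integer.Tactic.RingSolver using (solve-∀)
  open import Data.List.Membership.Propositional.Properties using (∈-map⁻)
  open import Data.List.Relation.Unary.Unique.Propositional.Properties using (map⁺; upTo⁺)
  open import Data.Empty using (⊥-elim)
  open ≡-Reasoning

  dot : Point → Point → ℤ
  dot (a , b) (x , y) = a * x + b * y

  shift-linear : ∀ s d k →
    shift s d k ≡ (proj₁ s + + k * proj₁ (dirVec d) , proj₂ s + + k * proj₂ (dirVec d))
  shift-linear _ horiz    _ = refl
  shift-linear _ vert     _ = refl
  shift-linear _ diag     _ = refl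
  shift-linear _ antidiag _ = refl

  dot-shift : ∀ u s d k → dot u (shift s d k) ≡ dot u s + + k * dot u (dirVec d)
  dot-shift (a , b) (x , y) d k rewrite shift-linear (x , y) d k =
    linearity a b x y (+ k) (proj₁ (dirVec d)) (proj₂ (dirVec d))
    where
    linearity : ∀ a b x y k dx dy →
      a * (x + k * dx) + b * (y + k * dy) ≡ (a * x + b * y) + k * (a * dx + b * dy)
    linearity = solve-∀

  normal : Dir → Point
  normal horiz    = (+ 0 , + 1)
  normal vert     = (+ 1 , + 0)
  normal diag     = (+ 1 , -[1+ 0 ])
  normal antidiag = (+ 1 , + 1)

  normal-orthogonal : ∀ d → dot (normal d) (dirVec d) ≡ 0ℤ
  normal-orthogonal horiz    = refl
  normal-orthogonal vert     = refl
  normal-orthogonal diag     = refl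
  normal-orthogonal antidiag = refl

  tangent : Dir → Point
  tangent vert = (+ 0 , + 1)
  tangent _    = (+ 1 , + 0)

  tangent-unit : ∀ d → dot (tangent d) (dirVec d) ≡ + 1
  tangent-unit horiz    = refl
  tangent-unit vert     = refl
  tangent-unit diag     = refl
  tangent-unit antidiag = refl

  -- Different steps along a direction give different points: the tangent coordinate separates them.
  shift-injective : ∀ s d {i j} → shift s d i ≡ shift s d j → i ≡ j
  shift-injective s d {i} {j} eq = +-injective (trans (cancel (dot t s) (+ i))
    (trans (cong (_- dot t s) (trans (sym (along i)) (trans (cong (dot t) eq) (along j))))
      (sym (cancel (dot t s) (+ j)))))
    where
    t = tangent d
    along : ∀ k → dot t (shift s d k) ≡ dot t s + + k
    along k = trans (dot-shift t s d k)
      (trans (cong (λ z → dot t s + + k * z) (tangent-unit d)) (unit (dot t s) (+ k)))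
      where
      unit : ∀ a k → a + k * + 1 ≡ a + k
      unit = solve-∀
    cancel : ∀ a x → x ≡ (a + x) - a
    cancel = solve-∀

  linePoints-unique : ∀ L → Unique (linePoints L)
  linePoints-unique (line s d) = map⁺ (shift-injective s d) (upTo⁺ 5)

  normal-constant : ∀ L {q} → q ∈ linePoints L → dot (normal (dir L)) q ≡ dot (normal (dir L)) (start L)
  normal-constant (line s d) q∈ with ∈-map⁻ (shift s d) {xs = upTo 5} q∈
  ... | k , _ , refl = trans (dot-shift n s d k)
    (trans (cong (λ z → dot n s + + k * z) (normal-orthogonal d)) (vanish (dot n s) (+ k)))
    where
    n = normal d
    vanish : ∀ a k → a + k * 0ℤ ≡ a
    vanish = solve-∀

  det : Point → Point → ℤ
  det (a , b) (c , e) = a * e - b * c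

  -- Cramer's rule: two linear forms with nonzero determinant determine a point.
  separate : ∀ n n' .{{_ : NonZero (det n n')}} {p q} →
    dot n p ≡ dot n q → dot n' p ≡ dot n' q → p ≡ q
  separate (a , b) (c , e) {x , y} {x' , y'} eq eq' = cong₂ _,_
    (*-cancelˡ-≡ D x x' (begin
      (D * x)                                  ≡⟨ cramer₁ a b c e x y ⟩
      e * dot (a , b) (x , y) - b * dot (c , e) (x , y)   ≡⟨ cong₂ (λ u v → e * u - b * v) eq eq' ⟩
      e * dot (a , b) (x' , y') - b * dot (c , e) (x' , y') ≡⟨ sym (cramer₁ a b c e x' y') ⟩
      D * x'                                   ∎))
    (*-cancelˡ-≡ D y y' (begin
      (D * y)                                  ≡⟨ cramer₂ a b c e x y ⟩
      a * dot (c , e) (x , y) - c * dot (a , b) (x , y)   ≡⟨ cong₂ (λ u v → a * u - c * v) eq' eq ⟩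
      a * dot (c , e) (x' , y') - c * dot (a , b) (x' , y') ≡⟨ sym (cramer₂ a b c e x' y') ⟩
      D * y'                                   ∎))
    where
    D = det (a , b) (c , e)
    cramer₁ : ∀ a b c e x y → (a * e - b * c) * x ≡ e * (a * x + b * y) - b * (c * x + e * y)
    cramer₁ = solve-∀
    cramer₂ : ∀ a b c e x y → (a * e - b * c) * y ≡ a * (c * x + e * y) - c * (a * x + b * y)
    cramer₂ = solve-∀

  normals-independent : ∀ d d' → d ≢ d' → NonZero (det (normal d) (normal d'))
  normals-independent horiz    horiz    d≢d' = ⊥-elim (d≢d' refl)
  normals-independent horiz    vert     _    = _
  normals-independent horiz    diag     _    = _
  normals-independent horiz    antidiag _    = _
  normals-independent vert     horiz    _    = _
  normals-independent vert     vert     d≢d' = ⊥-elim (d≢d' refl)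
  normals-independent vert     diag     _    = _
  normals-independent vert     antidiag _    = _
  normals-independent diag     horiz    _    = _
  normals-independent diag     vert     _    = _
  normals-independent diag     diag     d≢d' = ⊥-elim (d≢d' refl)
  normals-independent diag     antidiag _    = _
  normals-independent antidiag horiz    _    = _
  normals-independent antidiag vert     _    = _
  normals-independent antidiag diag     _    = _
  normals-independent antidiag antidiag d≢d' = ⊥-elim (d≢d' refl)

  meet-at-most-once : ∀ L L' → dir L ≢ dir L' → ∀ {x y} →
    x ∈ linePoints L → x ∈ linePoints L' → y ∈ linePoints L → y ∈ linePoints L' → x ≡ y
  meet-at-most-once L L' d≢d' xL xL' yL yL' =
    separate (normal (dir L)) (normal (dir L')) {{normals-independent (dir L) (dir L') d≢d'}}
      (trans (normal-constant L xL) (sym (normal-constant L yL)))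
      (trans (normal-constant L' xL') (sym (normal-constant L' yL')))

open Geometry using (linePoints-unique; meet-at-most-once)

open import Data.Nat using (ℕ; suc; _+_; _*_; z≤n; s≤s)
open import Data.Nat.Properties
  using ( ≤-refl; ≤-trans; ≤-reflexive; +-mono-≤; +-monoˡ-≤; +-monoʳ-≤; m≤n+m; +-identityʳ; +-assoc
        ; +-cancelʳ-≤; +-suc; *-zeroʳ; *-suc; *-identityˡ; module ≤-Reasoning)
open import Data.Nat.Tactic.RingSolver using (solve-∀)
import Data.Integer as ℤ
open import Data.Bool using (if_then_else_)
open import Data.Sum using (_⊎_; inj₁; inj₂)
open import Data.Unit using (tt)
open import Data.Empty using (⊥-elim)
open import Data.Product.Properties using (≡-dec)
open import Data.List.Relation.Unary.Any using (Any; here; there; any?; toSum; fromSum)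
open import Data.List.Relation.Unary.All as All using (All; []; _∷_)
open import Data.List.Relation.Unary.All.Properties using (All¬⇒¬Any)
open import Data.List.Relation.Unary.AllPairs using ([]; _∷_)
open import Relation.Nullary using (¬_; Dec; yes; no; does; _×-dec_)

ind : ∀ {a} {A : Set a} → Dec A → ℕ
ind a = if does a then 1 else 0

ind≤1 : ∀ {a} {A : Set a} (a? : Dec A) → ind a? ≤ 1
ind≤1 (yes _) = s≤s z≤n
ind≤1 (no _)  = z≤n

ind-false : ∀ {a} {A : Set a} → ¬ A → (a? : Dec A) → ind a? ≡ 0
ind-false ¬a (yes a) = ⊥-elim (¬a a)
ind-false ¬a (no _)  = refl

ind-subadditive : ∀ {A B C : Set} → (A → B ⊎ C) → (a : Dec A) (b : Dec B) (c : Dec C) → ind a ≤ ind b + ind c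
ind-subadditive f (no _)  _       _       = z≤n
ind-subadditive f (yes _) (yes _) _       = s≤s z≤n
ind-subadditive f (yes _) (no _)  (yes _) = s≤s z≤n
ind-subadditive f (yes x) (no ¬b) (no ¬c) with f x
... | inj₁ b = ⊥-elim (¬b b)
... | inj₂ c = ⊥-elim (¬c c)

ind-exclusive : ∀ {A B C : Set} → (B ⊎ C → A) → ¬ (B × C) → (a : Dec A) (b : Dec B) (c : Dec C) → ind b + ind c ≤ ind a
ind-exclusive f excl _       (yes b) (yes c) = ⊥-elim (excl (b , c))
ind-exclusive f excl (yes _) (yes _) (no _)  = ≤-refl
ind-exclusive f excl (yes _) (no _)  (yes _) = ≤-refl
ind-exclusive f excl (no ¬a) (yes b) (no _)  = ⊥-elim (¬a (f (inj₁ b)))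
ind-exclusive f excl (no ¬a) (no _)  (yes c) = ⊥-elim (¬a (f (inj₂ c)))
ind-exclusive f excl _       (no _)  (no _)  = z≤n

sumOf : ∀ {A : Set} → (A → ℕ) → List A → ℕ
sumOf f []       = 0
sumOf f (x ∷ xs) = f x + sumOf f xs

sumOf-mono : ∀ {A : Set} {f g : A → ℕ} → (∀ x → f x ≤ g x) → ∀ xs → sumOf f xs ≤ sumOf g xs
sumOf-mono f≤g []       = z≤n
sumOf-mono f≤g (x ∷ xs) = +-mono-≤ (f≤g x) (sumOf-mono f≤g xs)

sumOf-+ : ∀ {A : Set} (f g : A → ℕ) xs → sumOf (λ x → f x + g x) xs ≡ sumOf f xs + sumOf g xs
sumOf-+ f g []       = refl
sumOf-+ f g (x ∷ xs) = begin
  (f x + g x) + sumOf (λ x → f x + g x) xs ≡⟨ cong ((f x + g x) +_) (sumOf-+ f g xs) ⟩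
  (f x + g x) + (sumOf f xs + sumOf g xs)  ≡⟨ interchange (f x) (g x) (sumOf f xs) (sumOf g xs) ⟩
  (f x + sumOf f xs) + (g x + sumOf g xs)  ∎
  where
  open ≡-Reasoning
  interchange : ∀ a b c d → (a + b) + (c + d) ≡ (a + c) + (b + d)
  interchange = solve-∀

sumOf-++ : ∀ {A : Set} (f : A → ℕ) xs ys → sumOf f (xs ++ ys) ≡ sumOf f xs + sumOf f ys
sumOf-++ f []       ys = refl
sumOf-++ f (x ∷ xs) ys = trans (cong (f x +_) (sumOf-++ f xs ys)) (sym (+-assoc (f x) _ _))

sumOf-bounded : ∀ {A : Set} {f : A → ℕ} k → (∀ x → f x ≤ k) → ∀ xs → sumOf f xs ≤ k * length xs
sumOf-bounded k f≤k []       = ≤-reflexive (sym (*-zeroʳ k))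
sumOf-bounded k f≤k (x ∷ xs) =
  ≤-trans (+-mono-≤ (f≤k x) (sumOf-bounded k f≤k xs)) (≤-reflexive (sym (*-suc k (length xs))))

_≟D_ : (d d' : Dir) → Dec (d ≡ d')
horiz    ≟D horiz    = yes refl
horiz    ≟D vert     = no λ ()
horiz    ≟D diag     = no λ ()
horiz    ≟D antidiag = no λ ()
vert     ≟D horiz    = no λ ()
vert     ≟D vert     = yes refl
vert     ≟D diag     = no λ ()
vert     ≟D antidiag = no λ ()
diag     ≟D horiz    = no λ ()
diag     ≟D vert     = no λ ()
diag     ≟D diag     = yes refl
diag     ≟D antidiag = no λ ()
antidiag ≟D horiz    = no λ ()
antidiag ≟D vert     = no λ ()
antidiag ≟D diag     = no λ ()
antidiag ≟D antidiag = yes refl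

_≟P_ : (p q : Point) → Dec (p ≡ q)
_≟P_ = ≡-dec ℤ._≟_ ℤ._≟_

open import Data.List.Membership.DecPropositional _≟P_ using (_∈?_)

occurs : ∀ {q} cs → q ∈ cs → 1 ≤ sumOf (λ c → ind (c ≟P q)) cs
occurs {q} (c ∷ cs) (here refl) = +-mono-≤ (≤-reflexive (eq-ind (q ≟P q))) z≤n
  where
  eq-ind : (d : Dec (q ≡ q)) → 1 ≡ ind d
  eq-ind (yes _)  = refl
  eq-ind (no q≢q) = ⊥-elim (q≢q refl)
occurs {q} (c ∷ cs) (there q∈) = ≤-trans (occurs cs q∈) (m≤n+m _ (ind (c ≟P q)))

count-distinct : ∀ {Q cs} → Unique Q → All (_∈ cs) Q → length Q ≤ sumOf (λ c → ind (c ∈? Q)) cs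
count-distinct {[]}    _            _              = z≤n
count-distinct {q ∷ Q} {cs} (q≢Q ∷ uniq) (q∈cs ∷ Q⊆cs) = begin
  1 + length Q
    ≤⟨ +-mono-≤ (occurs cs q∈cs) (count-distinct uniq Q⊆cs) ⟩
  sumOf (λ c → ind (c ≟P q)) cs + sumOf (λ c → ind (c ∈? Q)) cs
    ≡⟨ sumOf-+ (λ c → ind (c ≟P q)) (λ c → ind (c ∈? Q)) cs ⟨
  sumOf (λ c → ind (c ≟P q) + ind (c ∈? Q)) cs
    ≤⟨ sumOf-mono (λ c → ind-exclusive fromSum (λ { (refl , q∈Q) → All¬⇒¬Any q≢Q q∈Q })
                                        (c ∈? q ∷ Q) (c ≟P q) (c ∈? Q)) cs ⟩
  sumOf (λ c → ind (c ∈? q ∷ Q)) cs ∎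
  where open ≤-Reasoning

allDirs : List Dir
allDirs = horiz ∷ vert ∷ diag ∷ antidiag ∷ []

Through : Line → Point → Dir → Set
Through l c d = dir l ≡ d × c ∈ linePoints l

through? : ∀ l c d → Dec (Through l c d)
through? l c d = (dir l ≟D d) ×-dec (c ∈? linePoints l)

Covered : List Line → Point → Dir → Set
Covered ls c d = Any (λ l → Through l c d) ls

covered? : ∀ ls c d → Dec (Covered ls c d)
covered? ls c d = any? (λ l → through? l c d) ls

used : List Line → Point → ℕ
used ls c = sumOf (λ d → ind (covered? ls c d)) allDirs

hits : List Line → Point → ℕ
hits ls c = sumOf (λ l → ind (c ∈? linePoints l)) ls

used≤4 : ∀ ls c → used ls c ≤ 4
used≤4 ls c = sumOf-bounded 1 (λ d → ind≤1 (covered? ls c d)) allDirs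

hits≤length : ∀ ls c → hits ls c ≤ length ls
hits≤length ls c = ≤-trans (sumOf-bounded 1 (λ l → ind≤1 (c ∈? linePoints l)) ls) (≤-reflexive (*-identityˡ _))

hits-++ : ∀ ls ls' c → hits (ls ++ ls') c ≡ hits ls c + hits ls' c
hits-++ ls ls' c = sumOf-++ (λ l → ind (c ∈? linePoints l)) ls ls'

through-once : ∀ l c → sumOf (λ d → ind (through? l c d)) allDirs ≡ ind (c ∈? linePoints l)
through-once (line _ horiz)    c = +-identityʳ _
through-once (line _ vert)     c = +-identityʳ _
through-once (line _ diag)     c = +-identityʳ _
through-once (line _ antidiag) c = +-identityʳ _

used-step : ∀ l ls c → used (l ∷ ls) c ≤ ind (c ∈? linePoints l) + used ls c
used-step l ls c = begin
  used (l ∷ ls) c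
    ≤⟨ sumOf-mono (λ d → ind-subadditive toSum (covered? (l ∷ ls) c d) (through? l c d) (covered? ls c d)) allDirs ⟩
  sumOf (λ d → ind (through? l c d) + ind (covered? ls c d)) allDirs
    ≡⟨ sumOf-+ (λ d → ind (through? l c d)) (λ d → ind (covered? ls c d)) allDirs ⟩
  sumOf (λ d → ind (through? l c d)) allDirs + used ls c
    ≡⟨ cong (_+ used ls c) (through-once l c) ⟩
  ind (c ∈? linePoints l) + used ls c ∎
  where open ≤-Reasoning

used-gain : ∀ l ls c → (c ∈ linePoints l → ¬ Covered ls c (dir l)) →
  ind (c ∈? linePoints l) + used ls c ≤ used (l ∷ ls) c
used-gain l ls c free = begin
  ind (c ∈? linePoints l) + used ls c
    ≡⟨ cong (_+ used ls c) (through-once l c) ⟨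
  sumOf (λ d → ind (through? l c d)) allDirs + used ls c
    ≡⟨ sumOf-+ (λ d → ind (through? l c d)) (λ d → ind (covered? ls c d)) allDirs ⟨
  sumOf (λ d → ind (through? l c d) + ind (covered? ls c d)) allDirs
    ≤⟨ sumOf-mono (λ d → ind-exclusive fromSum (λ { ((refl , c∈l) , cov) → free c∈l cov })
                                       (covered? (l ∷ ls) c d) (through? l c d) (covered? ls c d)) allDirs ⟩
  used (l ∷ ls) c ∎
  where open ≤-Reasoning

used≤hits : ∀ ls c → used ls c ≤ hits ls c
used≤hits []       c = z≤n
used≤hits (l ∷ ls) c = ≤-trans (used-step l ls c) (+-monoʳ-≤ (ind (c ∈? linePoints l)) (used≤hits ls c))

hits-none : ∀ ls {c} → All (λ l → c ∉ linePoints l) ls → hits ls c ≡ 0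
hits-none []       []           = refl
hits-none (l ∷ ls) {c} (c∉l ∷ c∉ls) = cong₂ _+_ (ind-false c∉l (c ∈? linePoints l)) (hits-none ls c∉ls)

lines-in-crosses : ∀ {h} → Game h → ∀ {l q} → l ∈ lines h → q ∈ linePoints l → q ∈ crosses h
lines-in-crosses (step _ (_ , _ , L⊆ , _)) (here refl) q∈ = All.lookup L⊆ q∈
lines-in-crosses (step g _)                (there l∈)  q∈ = there (lines-in-crosses g l∈ q∈)

hits-fresh : ∀ {h} → Game h → ∀ {c} → c ∉ crosses h → hits (lines h) c ≡ 0
hits-fresh {h} g c∉ = hits-none (lines h) (All.tabulate (λ l∈ c∈l → c∉ (lines-in-crosses g l∈ c∈l)))

length-crosses : ∀ h → length (crosses h) ≡ 36 + length h
length-crosses []      = refl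
length-crosses (m ∷ h) = trans (cong suc (length-crosses h)) (sym (+-suc 36 (length h)))

fresh-direction : ∀ {h m} → LegalMove h m →
  ∀ {c} → c ∈ linePoints (drawn m) → ¬ Covered (lines h) c (dir (drawn m))
fresh-direction (_ , _ , _ , disjoint) c∈L covered =
  All.lookupWith (λ sep (same-dir , c∈l) → sep same-dir (_ , c∈l , c∈L)) disjoint covered

potential : History → ℕ
potential h = sumOf (used (lines h)) (crosses h)

-- Each move raises the potential by at least 5: each of the 5 points of the new line gains a direction.
potential-step : ∀ {h m} → LegalMove h m → 5 + potential h ≤ potential (m ∷ h)
potential-step {h} {move p L} legal@(_ , _ , L⊆ , _) = begin
  5 + potential h
    ≤⟨ +-mono-≤ (count-distinct (linePoints-unique L) L⊆) (m≤n+m (potential h) (used ls p)) ⟩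
  sumOf (λ c → ind (c ∈? linePoints L)) cs + sumOf (used ls) cs
    ≡⟨ sumOf-+ (λ c → ind (c ∈? linePoints L)) (used ls) cs ⟨
  sumOf (λ c → ind (c ∈? linePoints L) + used ls c) cs
    ≤⟨ sumOf-mono (λ c → used-gain L ls c (fresh-direction {h} {move p L} legal)) cs ⟩
  potential (move p L ∷ h) ∎
  where
  open ≤-Reasoning
  ls = lines h
  cs = p ∷ crosses h

potential-lower : ∀ {h} → Game h → 5 * length h ≤ potential h
potential-lower {[]}    _              = z≤n
potential-lower {m ∷ h} (step g legal) = begin
  5 * suc (length h)  ≡⟨ *-suc 5 (length h) ⟩
  5 + 5 * length h    ≤⟨ +-monoʳ-≤ 5 (potential-lower g) ⟩
  5 + potential h     ≤⟨ potential-step {h} {m} legal ⟩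
  potential (m ∷ h)   ∎
  where open ≤-Reasoning

AtMostOneCommon : Line → Line → Set
AtMostOneCommon L L' = ∀ {x y} → x ∈ linePoints L → x ∈ linePoints L' → y ∈ linePoints L → y ∈ linePoints L' → x ≡ y

at-most-one-common : ∀ L L' → (dir L' ≡ dir L → ¬ ShareCommonPoint L' L) → AtMostOneCommon L L'
at-most-one-common L L' sep {x} xL xL' yL yL' with dir L' ≟D dir L
... | yes same  = ⊥-elim (sep same (x , xL' , xL))
... | no differ = meet-at-most-once L L' (λ eq → differ (sym eq)) xL xL' yL yL'

-- A point not on both lines is hit at most once by the pair (A = ⊤ in `ind-exclusive`).
pair-hits-point : ∀ L L' {q} → ¬ (q ∈ linePoints L × q ∈ linePoints L') → hits (L ∷ L' ∷ []) q ≤ 1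
pair-hits-point L L' {q} not-both = ≤-trans
  (≤-reflexive (cong (ind (q ∈? linePoints L) +_) (+-identityʳ (ind (q ∈? linePoints L')))))
  (ind-exclusive (λ _ → tt) not-both (yes tt) (q ∈? linePoints L) (q ∈? linePoints L'))

pair-hits-outside : ∀ L L' Q → All (λ y → ¬ (y ∈ linePoints L × y ∈ linePoints L')) Q →
  sumOf (hits (L ∷ L' ∷ [])) Q ≤ length Q
pair-hits-outside L L' []      []                  = z≤n
pair-hits-outside L L' (q ∷ Q) (not-both ∷ outside) =
  +-mono-≤ (pair-hits-point L L' not-both) (pair-hits-outside L L' Q outside)

pair-hits : ∀ L L' → AtMostOneCommon L L' → ∀ {Q} → Unique Q → sumOf (hits (L ∷ L' ∷ [])) Q ≤ suc (length Q)
pair-hits L L' one {[]}    []           = z≤n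
pair-hits L L' one {q ∷ Q} (q≢Q ∷ uniq) with q ∈? linePoints L ×-dec q ∈? linePoints L'
... | yes (qL , qL') = +-mono-≤ (hits≤length (L ∷ L' ∷ []) q)
  (pair-hits-outside L L' Q (All.map (λ q≢y (yL , yL') → q≢y (one qL qL' yL yL')) q≢Q))
... | no not-both = +-mono-≤ (pair-hits-point L L' not-both) (pair-hits L L' one uniq)

-- Lines drawn before a cross was placed do not pass through it, so its usage is bounded
-- by the number of later lines through it.
recent-usage : ∀ {h c} → Game h → c ∉ crosses h → ∀ later → used (later ++ lines h) c ≤ hits later c
recent-usage {h} {c} g c∉ later = begin
  used (later ++ lines h) c        ≤⟨ used≤hits (later ++ lines h) c ⟩
  hits (later ++ lines h) c        ≡⟨ hits-++ later (lines h) c ⟩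
  hits later c + hits (lines h) c  ≡⟨ cong (hits later c +_) (hits-fresh g c∉) ⟩
  hits later c + 0                 ≡⟨ +-identityʳ (hits later c) ⟩
  hits later c                     ∎
  where open ≤-Reasoning

hits-split : ∀ ls ls' c → hits (ls ++ ls') c ≤ hits ls c + length ls'
hits-split ls ls' c = ≤-trans (≤-reflexive (hits-++ ls ls' c)) (+-monoʳ-≤ (hits ls c) (hits≤length ls' c))

-- The four newest crosses p₁ (newest), …, p₄ have total usage at most 8.  Cross pᵢ can only lie on
-- the later lines L₁, …, Lᵢ; L₁ and L₂ share at most one point, so they hit p₂, p₃, p₄ at most
-- 4 times in total, while L₁ contributes at most 1 at p₁, L₃ at most 1 at p₃ and L₃, L₄ at most 2 at p₄.
newest-four-usage : ∀ {m₁ m₂ m₃ m₄ h} → Game (m₁ ∷ m₂ ∷ m₃ ∷ m₄ ∷ h) →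
  let ls = lines (m₁ ∷ m₂ ∷ m₃ ∷ m₄ ∷ h) in
  used ls (newCross m₁) + (used ls (newCross m₂) + (used ls (newCross m₃) + used ls (newCross m₄))) ≤ 8
newest-four-usage {move p₁ L₁} {move p₂ L₂} {move p₃ L₃} {move p₄ L₄} {h}
  (step g₂@(step g₃@(step g₄@(step g₅ (fresh₄ , _)) (fresh₃ , _)) (fresh₂ , _)) (fresh₁ , _ , _ , sep₂₁ ∷ _)) =
  begin
  u₁ + (u₂ + (u₃ + u₄))                   ≤⟨ +-mono-≤ bound₁ (+-mono-≤ bound₂ (+-mono-≤ bound₃ bound₄)) ⟩
  1 + (P p₂ + ((P p₃ + 1) + (P p₄ + 2)))
                                          ≡⟨ regroup (P p₂) (P p₃) (P p₄) ⟩
  4 + (P p₂ + (P p₃ + (P p₄ + 0)))        ≤⟨ +-monoʳ-≤ 4 (pair-hits L₁ L₂ (at-most-one-common L₁ L₂ sep₂₁) distinct) ⟩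
  8                                       ∎
  where
  open ≤-Reasoning
  ls = L₁ ∷ L₂ ∷ L₃ ∷ L₄ ∷ lines h
  u₁ = used ls p₁
  u₂ = used ls p₂
  u₃ = used ls p₃
  u₄ = used ls p₄
  P : Point → ℕ
  P = hits (L₁ ∷ L₂ ∷ [])
  bound₁ : u₁ ≤ 1
  bound₁ = ≤-trans (recent-usage g₂ fresh₁ (L₁ ∷ [])) (hits≤length (L₁ ∷ []) p₁)
  bound₂ : u₂ ≤ P p₂
  bound₂ = recent-usage g₃ fresh₂ (L₁ ∷ L₂ ∷ [])
  bound₃ : u₃ ≤ P p₃ + 1
  bound₃ = ≤-trans (recent-usage g₄ fresh₃ (L₁ ∷ L₂ ∷ L₃ ∷ [])) (hits-split (L₁ ∷ L₂ ∷ []) (L₃ ∷ []) p₃)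
  bound₄ : u₄ ≤ P p₄ + 2
  bound₄ = ≤-trans (recent-usage g₅ fresh₄ (L₁ ∷ L₂ ∷ L₃ ∷ L₄ ∷ [])) (hits-split (L₁ ∷ L₂ ∷ []) (L₃ ∷ L₄ ∷ []) p₄)
  regroup : ∀ a b c → 1 + (a + ((b + 1) + (c + 2))) ≡ 4 + (a + (b + (c + 0)))
  regroup = solve-∀
  distinct : Unique (p₂ ∷ p₃ ∷ p₄ ∷ [])
  distinct = ((λ eq → fresh₂ (here eq)) ∷ (λ eq → fresh₂ (there (here eq))) ∷ [])
           ∷ ((λ eq → fresh₃ (here eq)) ∷ []) ∷ [] ∷ []

potential-upper : ∀ {m₁ m₂ m₃ m₄ h} → Game (m₁ ∷ m₂ ∷ m₃ ∷ m₄ ∷ h) →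
  potential (m₁ ∷ m₂ ∷ m₃ ∷ m₄ ∷ h) + 8 ≤ 4 * length (crosses (m₁ ∷ m₂ ∷ m₃ ∷ m₄ ∷ h))
potential-upper {m₁} {m₂} {m₃} {m₄} {h} g = begin
  (u₁ + (u₂ + (u₃ + (u₄ + rest)))) + 8 ≡⟨ regroup u₁ u₂ u₃ u₄ rest ⟩
  ((u₁ + (u₂ + (u₃ + u₄))) + 8) + rest ≤⟨ +-mono-≤ (+-monoˡ-≤ 8 (newest-four-usage g)) (sumOf-bounded 4 (used≤4 ls) (crosses h)) ⟩
  16 + 4 * length (crosses h)          ≡⟨ four-more (length (crosses h)) ⟩
  4 * (4 + length (crosses h))         ∎
  where
  open ≤-Reasoning
  ls = lines (m₁ ∷ m₂ ∷ m₃ ∷ m₄ ∷ h)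
  u₁ = used ls (newCross m₁)
  u₂ = used ls (newCross m₂)
  u₃ = used ls (newCross m₃)
  u₄ = used ls (newCross m₄)
  rest = sumOf (used ls) (crosses h)
  regroup : ∀ a b c d r → (a + (b + (c + (d + r)))) + 8 ≡ ((a + (b + (c + d))) + 8) + r
  regroup = solve-∀
  four-more : ∀ n → 16 + 4 * n ≡ 4 * (4 + n)
  four-more = solve-∀

length-bound : ∀ k → 5 * k + 8 ≤ 4 * (36 + k) → k ≤ 136
length-bound k bound = +-cancelʳ-≤ 8 k 136 (+-cancelʳ-≤ (4 * k) (k + 8) 144
  (subst₂ _≤_ (split-five k) (split-four k) bound))
  where
  split-five : ∀ k → 5 * k + 8 ≡ (k + 8) + 4 * k
  split-five = solve-∀
  split-four : ∀ k → 4 * (36 + k) ≡ 144 + 4 * k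
  split-four = solve-∀

theorem3 : (h : History) → Game h → length h ≤ 136
theorem3 h@(_ ∷ _ ∷ _ ∷ _ ∷ _) g = length-bound (length h) (begin
  5 * length h + 8        ≤⟨ +-monoˡ-≤ 8 (potential-lower g) ⟩
  potential h + 8         ≤⟨ potential-upper g ⟩
  4 * length (crosses h)  ≡⟨ cong (4 *_) (length-crosses h) ⟩
  4 * (36 + length h)     ∎)
  where open ≤-Reasoning
theorem3 []                   _ = z≤n
theorem3 (_ ∷ [])             _ = s≤s z≤n
theorem3 (_ ∷ _ ∷ [])         _ = s≤s (s≤s z≤n)
theorem3 (_ ∷ _ ∷ _ ∷ [])     _ = s≤s (s≤s (s≤s z≤n))
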